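{- Let $G=(V,E)$ be an undirected unweighted connected graph on $n$ vertices with finite girth $g$, let $f$ be a positive integer with $n>f$, let $c\ge1$, let $k=\lceil 12(c+3)n^{1/f}\log n\rceil$, and let $A_0=V$ and $A_1,\dots,A_{f-1}\subseteq V$ be such that the sampling is good (as defined below). For each $i\in\{0,\dots,f-1\}$ let $M_i=\mathrm{Est}(A_i,k)$. Then there exists $i\in\{0,\dots,f-1\}$ with $M_i\le g(i+1)$.
   Context: $d$ is hop distance; logarithms base 2. Each vertex has a unique identifier; $x$ is closer to $v$ than $y$ if $d(v,x)<d(v,y)$, or $d(v,x)=d(v,y)$ and $ID(x)<ID(y)$. For $i\in\{1,\dots,f\}$, $Q_i(v)$ is the set of the $\lceil n^{i/f}\rceil$ vertices closest to $v$. The sampling is good if (1) for every $i\in\{1,\dots,f-1\}$ and $v\in V$, $Q_i(v)\cap A_i\ne\emptyset$, and (2) for every $i\in\{0,\dots,f-1\}$ and $v$, $|Q_{i+1}(v)\cap A_i|\le k$. For $S\subseteq V$, $U(S,k,v)$ is the set of the $k$ vertices of $S$ closest to $v$, or $S$ if $|S|\le k$. For $s\in V$ and $v\neq s$, $p(s,v)$ is a fixed BFS-tree parent of $v$ with respect to root $s$ (a neighbor with $d(s,p(s,v))=d(s,v)-1$); $p(s,s)$ is undefined. $\mathrm{Est}(S,k)=\min\{d(s,x)+d(s,y)+1 : \{x,y\}\in E,\ s\in U(S,k,x)\cap U(S,k,y),\ p(s,x)\ne y,\ p(s,y)\ne x\}$ (the output of the estimation procedure; $\min\emptyset=\infty$).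 -}

module Defs where

open import Data.Nat using (ℕ; zero; suc; _+_; _*_; _^_; _≤_; _<_; _≤ᵇ_; _<ᵇ_; _≡ᵇ_)
open import Data.Bool using (Bool; true; false; if_then_else_; _∧_; _∨_; not)
open import Data.Fin using (Fin; toℕ)
import Data.Fin as F
open import Data.List using (List; []; _∷_; length; concatMap; foldr)
open import Data.List.Relation.Unary.Unique.Propositional using (Unique)
open import Data.List using (allFin)
open import Data.Maybe using (Maybe; just; nothing)
open import Data.Product using (Σ; _×_; _,_; ∃)
open import Relation.Binary.PropositionalEquality using (_≡_; _≢_)
open import Relation.Nullary using (¬_; does)
open import Function using (_∘_)
open import Data.Empty using (⊥)

IsSimpleGraph : {n : ℕ} → (Fin n → Fin n → Bool) → Set
IsSimpleGraph {n} E =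
  (∀ (u v : Fin n) → E u v ≡ E v u) × (∀ (u : Fin n) → E u u ≡ false)

data Walk {n : ℕ} (E : Fin n → Fin n → Bool) : Fin n → Fin n → ℕ → Set where
  here  : ∀ u → Walk E u u 0
  step  : ∀ {u w v m} → E u w ≡ true → Walk E w v m → Walk E u v (suc m)

Connected : {n : ℕ} → (Fin n → Fin n → Bool) → Set
Connected {n} E = ∀ (u v : Fin n) → ∃ λ m → Walk E u v m

IsHopDistance : {n : ℕ} → (Fin n → Fin n → Bool) → (Fin n → Fin n → ℕ) → Set
IsHopDistance {n} E d =
  ∀ (u v : Fin n) → Walk E u v (d u v) × (∀ m → Walk E u v m → d u v ≤ m)

-- a (simple) cycle, given as the list of its vertices v0 … v(L-1)
consecAdj : {n : ℕ} → (Fin n → Fin n → Bool) → Fin n → List (Fin n) → Fin n → Set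
consecAdj E first [] prev = E prev first ≡ true
consecAdj E first (x ∷ xs) prev = (E prev x ≡ true) × consecAdj E first xs x

IsCycle : {n : ℕ} → (Fin n → Fin n → Bool) → List (Fin n) → Set
IsCycle E [] = ⊥
IsCycle E (v ∷ vs) = (3 ≤ length (v ∷ vs)) × Unique (v ∷ vs) × consecAdj E v vs v

IsGirth : {n : ℕ} → (Fin n → Fin n → Bool) → ℕ → Set
IsGirth {n} E g =
  (Σ (List (Fin n)) λ c → IsCycle E c × length c ≡ g)
  × (∀ (c : List (Fin n)) → IsCycle E c → g ≤ length c)

closer : {n : ℕ} → (Fin n → Fin n → ℕ) → (Fin n → ℕ) → Fin n → Fin n → Fin n → Bool
closer d ID v x y = (d v x <ᵇ d v y) ∨ ((d v x ≡ᵇ d v y) ∧ (ID x <ᵇ ID y))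

count : {n : ℕ} → (Fin n → Bool) → ℕ
count {zero} P = 0
count {suc n} P = (if P F.zero then 1 else 0) + count (P ∘ F.suc)

-- least m ≤ b with P m (or b if none)
leastUpTo : (ℕ → Bool) → ℕ → ℕ
leastUpTo P zero = 0
leastUpTo P (suc b) = if P 0 then 0 else suc (leastUpTo (P ∘ suc) b)

-- ⌈ n^(i/f) ⌉ = least m with n^i ≤ m^f   (for f ≥ 1, n ≥ 1)
ceilPow : ℕ → ℕ → ℕ → ℕ
ceilPow n i f = leastUpTo (λ m → (n ^ i) ≤ᵇ (m ^ f)) (n ^ i)

-- membership in the set of the q vertices of S closest to v
-- (x is among them iff fewer than q vertices of S are closer to v than x)
inClosest : {n : ℕ} → (Fin n → Fin n → ℕ) → (Fin n → ℕ) →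
            (Fin n → Bool) → ℕ → Fin n → Fin n → Bool
inClosest d ID S q v x = S x ∧ (count (λ t → S t ∧ closer d ID v t x) <ᵇ q)

allV : {n : ℕ} → Fin n → Bool
allV _ = true

inQ : {n : ℕ} → (Fin n → Fin n → ℕ) → (Fin n → ℕ) → ℕ → ℕ → Fin n → Fin n → Bool
inQ {n} d ID f i v x = inClosest d ID allV (ceilPow n i f) v x

inU : {n : ℕ} → (Fin n → Fin n → ℕ) → (Fin n → ℕ) →
      (Fin n → Bool) → ℕ → Fin n → Fin n → Bool
inU d ID S k v s = inClosest d ID S k v s

GoodSampling : {n : ℕ} → (Fin n → Fin n → ℕ) → (Fin n → ℕ) →
               ℕ → ℕ → (ℕ → Fin n → Bool) → Set
GoodSampling {n} d ID f k A =
  (∀ (i : ℕ) → 1 ≤ i → i < f → ∀ (v : Fin n) →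
      ∃ λ (x : Fin n) → (inQ d ID f i v x ≡ true) × (A i x ≡ true))
  × (∀ (i : ℕ) → i < f → ∀ (v : Fin n) →
      count (λ x → inQ d ID f (suc i) v x ∧ A i x) ≤ k)

IsBFSParent : {n : ℕ} → (Fin n → Fin n → Bool) → (Fin n → Fin n → ℕ) →
              (Fin n → Fin n → Fin n) → Set
IsBFSParent {n} E d p =
  ∀ (s v : Fin n) → v ≢ s → (E v (p s v) ≡ true) × (suc (d s (p s v)) ≡ d s v)

-- Est(S,k) as an element of ℕ ∪ {∞}  (nothing = ∞)

minM : Maybe ℕ → Maybe ℕ → Maybe ℕ
minM nothing b = b
minM (just a) nothing = just a
minM (just a) (just b) = just (a Data.Nat.⊓ b)

_==_ : {n : ℕ} → Fin n → Fin n → Bool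
x == y = does (x F.≟ y)

-- "p(s,x) ≠ y", read as true when p(s,x) is undefined (x = s)
parentNot : {n : ℕ} → (Fin n → Fin n → Fin n) → Fin n → Fin n → Fin n → Bool
parentNot p s x y = (x == s) ∨ not (p s x == y)

estCandidate : {n : ℕ} → (Fin n → Fin n → Bool) → (Fin n → Fin n → ℕ) → (Fin n → ℕ) →
               (Fin n → Fin n → Fin n) → (Fin n → Bool) → ℕ →
               Fin n → Fin n → Fin n → Maybe ℕ
estCandidate E d ID p S k s x y =
  if E x y ∧ inU d ID S k x s ∧ inU d ID S k y s ∧ parentNot p s x y ∧ parentNot p s y x
  then just (d s x + d s y + 1) else nothing

Est : {n : ℕ} → (Fin n → Fin n → Bool) → (Fin n → Fin n → ℕ) → (Fin n → ℕ) →
      (Fin n → Fin n → Fin n) → (Fin n → Bool) → ℕ → Maybe ℕ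
Est {n} E d ID p S k =
  foldr minM nothing
    (concatMap (λ s → concatMap (λ x → Data.List.map (estCandidate E d ID p S k s x) (allFin n))
                                (allFin n))
               (allFin n))

-- k ≥ 48 · n^(1/f) · log₂ n, expressed in ℕ:
-- for every rational p/q ≤ log₂ n (i.e. 2^p ≤ n^q), k·q ≥ 48·p·n^(1/f).

KLarge : ℕ → ℕ → ℕ → Set
KLarge n f k = ∀ (a q : ℕ) → 1 ≤ q → 2 ^ a ≤ n ^ q → (48 * a) ^ f * n ≤ (k * q) ^ f

-- Fix a cycle C of length g and read it as the g-periodic closed walk w : ℕ → V, w j = C[j mod g].
-- Any two vertices of C are at distance at most g/2, and for a vertex z and an edge {x, y} of C,
-- d(z,x) + d(z,y) + 1 ≤ g.
--
-- Level i carries a source s ∈ A_i and a vertex w a of C with 2 d(w a, s) ≤ g i (at level 0, s = w 0).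
-- If s ∈ U(A_i, k, x) for every x on C, take the vertex x of C farthest from s: neither cycle
-- neighbour of x is a BFS child of x, and only one of them can be its parent, so one of the two
-- cycle edges at x is a candidate of Est(A_i, k), of value at most 2 d(w a, s) + g ≤ g (i + 1).
-- Otherwise s ∉ U(A_i, k, w b) for some b, so s ∉ Q_{i+1}(w b) by condition (2) of good sampling.
-- Since Q_f(w b) = V this forces i + 1 < f, and condition (1) supplies s′ ∈ A_{i+1} ∩ Q_{i+1}(w b),
-- which is no farther from w b than s; then s′ and w b carry level i + 1.

module Submission where

open import Defs
open import Data.Nat
  using (ℕ; zero; suc; _+_; _∸_; _*_; _^_; _≤_; _<_; _<ᵇ_; _≤ᵇ_; z≤n; s≤s; z<s; _⊓_; pred; NonZero; >-nonZero)
open import Data.Nat.Properties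
open import Data.Nat.DivMod
  using (_%_; _/_; m≡m%n+[m/n]*n; m%n<n; m<n⇒m%n≡m; n%n≡0; [m+n]%n≡m%n; %-distribˡ-+)
open import Data.Nat.Divisibility using (divides; ∣m+n∣m⇒∣n; n∣m*n; ∣⇒≤)
open import Data.Nat.Tactic.RingSolver using (solve-∀)
open import Data.Fin using (Fin)
import Data.Fin as F
open import Data.Bool using (Bool; true; false; _∧_)
import Data.Bool as Bool
open import Data.Bool.Properties using (T-≡; T-∧; T-∨; ¬-not; ∧-conicalˡ; ∧-conicalʳ)
open import Data.Maybe using (Maybe; just; nothing)
open import Data.Product using (∃; _×_; _,_; proj₁; proj₂)
open import Data.Sum using (_⊎_; inj₁; inj₂)
open import Data.List using (List; []; _∷_; length; foldr; upTo)
open import Data.List.Relation.Unary.Any using (here; there)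
import Data.List.Relation.Unary.All as All
open import Data.List.Relation.Unary.All using (all?)
open import Data.List.Relation.Unary.All.Properties using (¬All⇒Any¬)
open import Data.List.Relation.Unary.AllPairs using (_∷_)
open import Data.List.Relation.Unary.Unique.Propositional using (Unique)
open import Data.List.Membership.Propositional using (_∈_; lose; find)
open import Data.List.Membership.Propositional.Properties using (∈-allFin; ∈-map⁺; ∈-concatMap⁺; ∈-upTo⁺)
open import Data.List.Extrema.Nat using (argmax; f[xs]≤f[argmax])
open import Function using (_∘_; Injective)
open import Function.Bundles using (module Equivalence)
open import Relation.Binary.PropositionalEquality
  using (_≡_; _≢_; refl; sym; trans; cong; cong₂; subst; module ≡-Reasoning)
open import Relation.Nullary using (¬_; yes; no; contradiction)
open import Relation.Unary using (Decidable)

open Equivalence using (to; from)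

variable
  n : ℕ

count-mono : (P Q : Fin n → Bool) → (∀ t → P t ≡ true → Q t ≡ true) → count P ≤ count Q
count-mono {zero} P Q P⊆Q = z≤n
count-mono {suc n} P Q P⊆Q with P F.zero in p₀ | Q F.zero in q₀
... | true  | false = contradiction (trans (sym (P⊆Q F.zero p₀)) q₀) λ ()
... | true  | true  = s≤s (count-mono (P ∘ F.suc) (Q ∘ F.suc) (P⊆Q ∘ F.suc))
... | false | true  = m≤n⇒m≤1+n (count-mono (P ∘ F.suc) (Q ∘ F.suc) (P⊆Q ∘ F.suc))
... | false | false = count-mono (P ∘ F.suc) (Q ∘ F.suc) (P⊆Q ∘ F.suc)

count-mono-< : (P Q : Fin n → Bool) → (∀ t → P t ≡ true → Q t ≡ true) →
               ∀ t₀ → P t₀ ≢ true → Q t₀ ≡ true → count P < count Q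
count-mono-< {suc n} P Q P⊆Q F.zero ¬p₀ q₀ rewrite ¬-not ¬p₀ | q₀ =
  s≤s (count-mono (P ∘ F.suc) (Q ∘ F.suc) (P⊆Q ∘ F.suc))
count-mono-< {suc n} P Q P⊆Q (F.suc t₀) ¬p₀ q₀ with P F.zero in p₀ | Q F.zero in q₀′
... | true  | false = contradiction (trans (sym (P⊆Q F.zero p₀)) q₀′) λ ()
... | true  | true  = s≤s (count-mono-< (P ∘ F.suc) (Q ∘ F.suc) (P⊆Q ∘ F.suc) t₀ ¬p₀ q₀)
... | false | true  = m<n⇒m<1+n (count-mono-< (P ∘ F.suc) (Q ∘ F.suc) (P⊆Q ∘ F.suc) t₀ ¬p₀ q₀)
... | false | false = count-mono-< (P ∘ F.suc) (Q ∘ F.suc) (P⊆Q ∘ F.suc) t₀ ¬p₀ q₀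

count-const-true : count {n} (λ _ → true) ≡ n
count-const-true {zero} = refl
count-const-true {suc n} = cong suc count-const-true

count-<-n : (P : Fin n → Bool) → ∀ t₀ → P t₀ ≢ true → count P < n
count-<-n P t₀ ¬p₀ =
  subst (count P <_) count-const-true (count-mono-< P _ (λ _ _ → refl) t₀ ¬p₀ refl)

<ᵇ≡true⇒< : ∀ {m n} → (m <ᵇ n) ≡ true → m < n
<ᵇ≡true⇒< {m} {n} h = <ᵇ⇒< m n (T-≡ .from h)

<⇒<ᵇ≡true : ∀ {m n} → m < n → (m <ᵇ n) ≡ true
<⇒<ᵇ≡true = T-≡ .to ∘ <⇒<ᵇ

n≤n^f : ∀ n {f} → 1 ≤ f → n ≤ n ^ f
n≤n^f zero _ = z≤n
n≤n^f n@(suc _) {f} 1≤f = subst (_≤ n ^ f) (^-identityʳ n) (^-monoʳ-≤ n 1≤f)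

leastUpTo-≥ : (P : ℕ → Bool) → ∀ {m b} → (∀ j → j < m → P j ≢ true) → m ≤ b →
              m ≤ leastUpTo P b
leastUpTo-≥ P {zero} _ _ = z≤n
leastUpTo-≥ P {suc m} {suc b} none m≤b rewrite ¬-not (none 0 z<s) =
  s≤s (leastUpTo-≥ (P ∘ suc) (λ j j<m → none (suc j) (s≤s j<m)) (≤-pred m≤b))

n≤ceilPow : ∀ n {f} → 1 ≤ f → n ≤ ceilPow n f f
n≤ceilPow n {f} 1≤f = leastUpTo-≥ _ too-small (n≤n^f n 1≤f)
  where
  too-small : ∀ j → j < n → (n ^ f ≤ᵇ j ^ f) ≢ true
  too-small j j<n h = <⇒≱ (^-monoˡ-< f {{>-nonZero 1≤f}} j<n) (≤ᵇ⇒≤ _ _ (T-≡ .from h))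

%-+-≢ : ∀ m {k n} .{{_ : NonZero n}} .{{_ : NonZero k}} → k < n → (m + k) % n ≢ m % n
%-+-≢ m {k} {n} k<n eq = <⇒≱ k<n (∣⇒≤ (∣m+n∣m⇒∣n (divides ((m + k) / n) same) (n∣m*n (m / n))))
  where
  open ≡-Reasoning
  same : m / n * n + k ≡ (m + k) / n * n
  same = +-cancelˡ-≡ (m % n) _ _ (begin
    m % n + (m / n * n + k)       ≡⟨ +-assoc (m % n) (m / n * n) k ⟨
    m % n + m / n * n + k         ≡⟨ cong (_+ k) (m≡m%n+[m/n]*n m n) ⟨
    m + k                         ≡⟨ m≡m%n+[m/n]*n (m + k) n ⟩
    (m + k) % n + (m + k) / n * n ≡⟨ cong (_+ (m + k) / n * n) eq ⟩
    m % n + (m + k) / n * n       ∎)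

module Closeness (d : Fin n → Fin n → ℕ) (ID : Fin n → ℕ) where

  Lex : Fin n → Fin n → Fin n → Set
  Lex v x y = d v x < d v y ⊎ (d v x ≡ d v y × ID x < ID y)

  closer⇒Lex : ∀ {v x y} → closer d ID v x y ≡ true → Lex v x y
  closer⇒Lex h with T-∨ .to (T-≡ .from h)
  ... | inj₁ lt = inj₁ (<ᵇ⇒< _ _ lt)
  ... | inj₂ eq∧lt with T-∧ .to eq∧lt
  ...   | eq , lt = inj₂ (≡ᵇ⇒≡ _ _ eq , <ᵇ⇒< _ _ lt)

  Lex⇒closer : ∀ {v x y} → Lex v x y → closer d ID v x y ≡ true
  Lex⇒closer (inj₁ lt) = T-≡ .to (T-∨ .from (inj₁ (<⇒<ᵇ lt)))
  Lex⇒closer (inj₂ (eq , lt)) = T-≡ .to (T-∨ .from (inj₂ (T-∧ .from (≡⇒≡ᵇ _ _ eq , <⇒<ᵇ lt))))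

  closer-irrefl : ∀ {v x} → closer d ID v x x ≢ true
  closer-irrefl h with closer⇒Lex h
  ... | inj₁ lt = <-irrefl refl lt
  ... | inj₂ (_ , lt) = <-irrefl refl lt

  closer-trans : ∀ {v x y z} → closer d ID v x y ≡ true → closer d ID v y z ≡ true →
                 closer d ID v x z ≡ true
  closer-trans h₁ h₂ = Lex⇒closer (Lex-trans (closer⇒Lex h₁) (closer⇒Lex h₂))
    where
    Lex-trans : ∀ {v x y z} → Lex v x y → Lex v y z → Lex v x z
    Lex-trans (inj₁ lt) (inj₁ lt′) = inj₁ (<-trans lt lt′)
    Lex-trans {v} {x} (inj₁ lt) (inj₂ (eq′ , _)) = inj₁ (subst (d v x <_) eq′ lt)
    Lex-trans {v} {z = z} (inj₂ (eq , _)) (inj₁ lt′) = inj₁ (subst (_< d v z) (sym eq) lt′)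
    Lex-trans (inj₂ (eq , lt)) (inj₂ (eq′ , lt′)) = inj₂ (trans eq eq′ , <-trans lt lt′)

  inClosest-closer : ∀ {S q v y t} → inClosest d ID S q v y ≡ true → S t ≡ true →
                     closer d ID v t y ≡ true → inClosest d ID S q v t ≡ true
  inClosest-closer {S} {q} {v} {y} {t} y∈ t∈S t<y =
    cong₂ _∧_ t∈S (<⇒<ᵇ≡true {n = q} (<-trans fewer (<ᵇ≡true⇒< (∧-conicalʳ (S y) _ y∈))))
    where
    fewer : count (λ u → S u ∧ closer d ID v u t) < count (λ u → S u ∧ closer d ID v u y)
    fewer = count-mono-< _ _
      (λ u h → cong₂ _∧_ (∧-conicalˡ _ _ h) (closer-trans (∧-conicalʳ (S u) _ h) t<y))
      t (closer-irrefl ∘ ∧-conicalʳ _ _) (cong₂ _∧_ t∈S t<y)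

  inQ-nearer : ∀ {f i v s s′} → inQ d ID f i v s ≢ true → inQ d ID f i v s′ ≡ true → d v s′ ≤ d v s
  inQ-nearer {f} {i} s∉Q s′∈Q =
    ≮⇒≥ λ lt → s∉Q (inClosest-closer {q = ceilPow n i f} s′∈Q refl (Lex⇒closer (inj₁ lt)))

  ∉U⇒∉Q : ∀ {f i S k x s} → S s ≡ true → inU d ID S k x s ≢ true →
          count (λ t → inQ d ID f i x t ∧ S t) ≤ k → inQ d ID f i x s ≢ true
  ∉U⇒∉Q {f} {i} {S} {k} {x} {s} s∈S s∉U few s∈Q =
    s∉U (cong₂ _∧_ s∈S (<⇒<ᵇ≡true (<-≤-trans fewer few)))
    where
    fewer : count (λ t → S t ∧ closer d ID x t s) < count (λ t → inQ d ID f i x t ∧ S t)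
    fewer = count-mono-< _ _
      (λ t h → cong₂ _∧_ (inClosest-closer {q = ceilPow n i f} s∈Q refl (∧-conicalʳ (S t) _ h))
                         (∧-conicalˡ _ _ h))
      s (closer-irrefl ∘ ∧-conicalʳ _ _) (cong₂ _∧_ s∈Q s∈S)

  inQ-top : ∀ {f} → 1 ≤ f → ∀ v x → inQ d ID f f v x ≡ true
  inQ-top 1≤f v x =
    <⇒<ᵇ≡true (<-≤-trans (count-<-n _ x closer-irrefl) (n≤ceilPow _ 1≤f))

infix 4 _≤ₘ_
_≤ₘ_ : Maybe ℕ → ℕ → Set
M ≤ₘ b = ∃ λ m → M ≡ just m × m ≤ b

≤ₘ-trans : ∀ {M a b} → M ≤ₘ a → a ≤ b → M ≤ₘ b
≤ₘ-trans (m , M≡m , m≤a) a≤b = m , M≡m , ≤-trans m≤a a≤b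

minM-≤ₘˡ : ∀ v M → minM (just v) M ≤ₘ v
minM-≤ₘˡ v nothing = v , refl , ≤-refl
minM-≤ₘˡ v (just b) = v ⊓ b , refl , m⊓n≤m v b

minM-≤ₘʳ : ∀ M {N b} → N ≤ₘ b → minM M N ≤ₘ b
minM-≤ₘʳ nothing N≤b = N≤b
minM-≤ₘʳ (just a) (m , refl , m≤b) = a ⊓ m , refl , ≤-trans (m⊓n≤n a m) m≤b

foldr-minM-≤ₘ : ∀ {v} xs → just v ∈ xs → foldr minM nothing xs ≤ₘ v
foldr-minM-≤ₘ (_ ∷ xs) (here refl) = minM-≤ₘˡ _ (foldr minM nothing xs)
foldr-minM-≤ₘ (x ∷ xs) (there v∈xs) = minM-≤ₘʳ x (foldr-minM-≤ₘ xs v∈xs)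

module _ (E : Fin n → Fin n → Bool) (d : Fin n → Fin n → ℕ) (ID : Fin n → ℕ)
         (p : Fin n → Fin n → Fin n) (S : Fin n → Bool) (k : ℕ) {s x y : Fin n}
         (xy∈E : E x y ≡ true) (s∈Ux : inU d ID S k x s ≡ true) (s∈Uy : inU d ID S k y s ≡ true)
         (px≢y : parentNot p s x y ≡ true) (py≢x : parentNot p s y x ≡ true) where

  estCandidate≡ : estCandidate E d ID p S k s x y ≡ just (d s x + d s y + 1)
  estCandidate≡ rewrite xy∈E | s∈Ux | s∈Uy | px≢y | py≢x = refl

  Est-≤ₘ : Est E d ID p S k ≤ₘ d s x + d s y + 1
  Est-≤ₘ = foldr-minM-≤ₘ _ (∈-concatMap⁺ _ (lose (∈-allFin s) (∈-concatMap⁺ _ (lose (∈-allFin x)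
    (subst (_∈ _) estCandidate≡ (∈-map⁺ (estCandidate E d ID p S k s x) (∈-allFin y)))))))

parentNot-or-parent : (p : Fin n → Fin n → Fin n) → ∀ s x y →
                      parentNot p s x y ≡ true ⊎ (x ≢ s × p s x ≡ y)
parentNot-or-parent p s x y with x F.≟ s | p s x F.≟ y
... | yes _ | _ = inj₁ refl
... | no x≢s | yes px≡y = inj₂ (x≢s , px≡y)
... | no _ | no _ = inj₁ refl

module HopDistance {E : Fin n → Fin n → Bool} {d : Fin n → Fin n → ℕ}
                   (E-sym : ∀ u v → E u v ≡ E v u) (hop : IsHopDistance E d) where

  walk-++ : ∀ {u v w a b} → Walk E u v a → Walk E v w b → Walk E u w (a + b)
  walk-++ (here _) q = q
  walk-++ (step e r) q = step e (walk-++ r q)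

  walk-reverse : ∀ {u v a} → Walk E u v a → Walk E v u a
  walk-reverse (here u) = here u
  walk-reverse {u} (step {m = m} e r) =
    subst (Walk E _ u) (+-comm m 1) (walk-++ (walk-reverse r) (step (trans (E-sym _ _) e) (here u)))

  d≤walk : ∀ {u v m} → Walk E u v m → d u v ≤ m
  d≤walk {u} {v} = proj₂ (hop u v) _

  d-sym : ∀ u v → d u v ≡ d v u
  d-sym u v =
    ≤-antisym (d≤walk (walk-reverse (proj₁ (hop v u)))) (d≤walk (walk-reverse (proj₁ (hop u v))))

  d-triangle : ∀ u v w → d u w ≤ d u v + d v w
  d-triangle u v w = d≤walk (walk-++ (proj₁ (hop u v)) (proj₁ (hop v w)))

  d-refl : ∀ u → d u u ≡ 0
  d-refl u = n≤0⇒n≡0 (d≤walk (here u))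

module ClosedWalk {E : Fin n → Fin n → Bool} {d : Fin n → Fin n → ℕ}
                  (E-sym : ∀ u v → E u v ≡ E v u) (hop : IsHopDistance E d)
                  (g : ℕ) .{{_ : NonZero g}} (w : ℕ → Fin n)
                  (w-step : ∀ j → E (w j) (w (suc j)) ≡ true) (w-periodic : ∀ j → w (j + g) ≡ w j) where

  open HopDistance E-sym hop

  w-periodic* : ∀ j q → w (j + q * g) ≡ w j
  w-periodic* j zero = cong w (+-identityʳ j)
  w-periodic* j (suc q) = begin
    w (j + (g + q * g)) ≡⟨ cong w (swap j g (q * g)) ⟩
    w (j + q * g + g)   ≡⟨ w-periodic (j + q * g) ⟩
    w (j + q * g)       ≡⟨ w-periodic* j q ⟩
    w j                 ∎
    where
    open ≡-Reasoning
    swap : ∀ a b c → a + (b + c) ≡ a + c + b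
    swap = solve-∀

  -- The offset is t = (c + a (g - 1)) % g, because c + a g = a + (c + a (g - 1)).
  w-offset : ∀ a c → ∃ λ t → t < g × (∀ i → w (i + c) ≡ w (i + (a + t)))
  w-offset a c = N % g , m%n<n N g , λ i → begin
    w (i + c)                       ≡⟨ w-periodic* (i + c) a ⟨
    w (i + c + a * g)               ≡⟨ cong w (lift i) ⟩
    w (i + (a + N % g) + N / g * g) ≡⟨ w-periodic* (i + (a + N % g)) (N / g) ⟩
    w (i + (a + N % g))             ∎
    where
    open ≡-Reasoning
    N : ℕ
    N = c + a * pred g

    expand : ∀ i c a h → i + c + a * suc h ≡ i + a + (c + a * h)
    expand = solve-∀

    regroup : ∀ i a r u → i + a + (r + u) ≡ i + (a + r) + u
    regroup = solve-∀

    lift : ∀ i → i + c + a * g ≡ i + (a + N % g) + N / g * g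
    lift i = begin
      i + c + a * g               ≡⟨ cong (λ h → i + c + a * h) (suc-pred g) ⟨
      i + c + a * suc (pred g)    ≡⟨ expand i c a (pred g) ⟩
      i + a + N                   ≡⟨ cong (i + a +_) (m≡m%n+[m/n]*n N g) ⟩
      i + a + (N % g + N / g * g) ≡⟨ regroup i a (N % g) (N / g * g) ⟩
      i + (a + N % g) + N / g * g ∎

  w-reduce : ∀ c → ∃ λ t → t < g × w c ≡ w t
  w-reduce c with w-offset 0 c
  ... | t , t<g , w≡ = t , t<g , w≡ 0

  w-pred : ∀ c → w (suc (c + pred g)) ≡ w c
  w-pred c = trans (cong w (trans (sym (+-suc c (pred g))) (cong (c +_) (suc-pred g)))) (w-periodic c)

  walk-along : ∀ a t → Walk E (w a) (w (a + t)) t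
  walk-along a zero = subst (λ j → Walk E (w a) (w j) 0) (sym (+-identityʳ a)) (here (w a))
  walk-along a (suc t) = step (w-step a)
    (subst (λ j → Walk E (w (suc a)) (w j) t) (sym (+-suc a t)) (walk-along (suc a) t))

  d-along : ∀ a t → d (w a) (w (a + t)) ≤ t
  d-along a t = d≤walk (walk-along a t)

  d-back : ∀ a t → t ≤ g → d (w (a + t)) (w a) ≤ g ∸ t
  d-back a t t≤g = subst (λ x → d (w (a + t)) x ≤ g ∸ t) around (d-along (a + t) (g ∸ t))
    where
    around : w (a + t + (g ∸ t)) ≡ w a
    around = trans (cong w (trans (+-assoc a t (g ∸ t)) (cong (a +_) (m+[n∸m]≡n t≤g)))) (w-periodic a)

  open ≤-Reasoning

  d-cycle-double : ∀ a c → d (w a) (w c) + d (w a) (w c) ≤ g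
  d-cycle-double a c with w-offset a c
  ... | t , t<g , w≡ rewrite w≡ 0 = begin
    d (w a) (w (a + t)) + d (w a) (w (a + t)) ≡⟨ cong (d (w a) (w (a + t)) +_) (d-sym _ _) ⟩
    d (w a) (w (a + t)) + d (w (a + t)) (w a) ≤⟨ +-mono-≤ (d-along a t) (d-back a t (<⇒≤ t<g)) ⟩
    t + (g ∸ t)                               ≡⟨ m+[n∸m]≡n (<⇒≤ t<g) ⟩
    g                                         ∎

  d-cycle-edge : ∀ a c → d (w a) (w c) + d (w a) (w (suc c)) + 1 ≤ g
  d-cycle-edge a c with w-offset a c
  ... | t , t<g , w≡ rewrite w≡ 0 | w≡ 1 = begin
    d (w a) (w (a + t)) + d (w a) (w (suc (a + t))) + 1 ≡⟨ cong (λ x → d (w a) (w (a + t)) + x + 1) back ⟩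
    d (w a) (w (a + t)) + d (w (a + suc t)) (w a) + 1   ≤⟨ +-monoˡ-≤ 1 (+-mono-≤ (d-along a t) back≤) ⟩
    t + (g ∸ suc t) + 1                                 ≡⟨ +-comm (t + (g ∸ suc t)) 1 ⟩
    suc t + (g ∸ suc t)                                 ≡⟨ m+[n∸m]≡n t<g ⟩
    g                                                   ∎
    where
    back : d (w a) (w (suc (a + t))) ≡ d (w (a + suc t)) (w a)
    back = trans (d-sym _ _) (cong (λ j → d (w j) (w a)) (sym (+-suc a t)))

    back≤ : d (w (a + suc t)) (w a) ≤ g ∸ suc t
    back≤ = d-back a (suc t) t<g

  farthest : (D : Fin n → ℕ) → ∃ λ c → ∀ c′ → D (w c′) ≤ D (w c)
  farthest D = argmax (D ∘ w) 0 (upTo g) , below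
    where
    below : ∀ c′ → D (w c′) ≤ D (w (argmax (D ∘ w) 0 (upTo g)))
    below c′ with w-reduce c′
    ... | t , t<g , w≡ rewrite w≡ = All.lookup (f[xs]≤f[argmax] 0 (upTo g)) (∈-upTo⁺ t<g)

  all-or-counterexample : {P : Fin n → Set} → Decidable P → (∀ c → P (w c)) ⊎ ∃ λ c → ¬ P (w c)
  all-or-counterexample {P} P? with all? (P? ∘ w) (upTo g)
  ... | yes all = inj₁ λ c → let (t , t<g , w≡) = w-reduce c in
                             subst P (sym w≡) (All.lookup all (∈-upTo⁺ t<g))
  ... | no ¬all = let (t , _ , ¬Pt) = find (¬All⇒Any¬ (P? ∘ w) (upTo g) ¬all) in inj₂ (t , ¬Pt)

nth : {A : Set} → A → List A → ℕ → A
nth z [] _ = z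
nth z (x ∷ xs) zero = x
nth z (x ∷ xs) (suc i) = nth z xs i

module _ {A : Set} (z : A) where

  nth-∈ : ∀ xs {i} → i < length xs → nth z xs i ∈ xs
  nth-∈ (x ∷ xs) {zero} _ = here refl
  nth-∈ (x ∷ xs) {suc i} (s≤s i<) = there (nth-∈ xs i<)

  nth-injective : ∀ {xs} → Unique xs → ∀ {i j} → i < length xs → j < length xs →
                  nth z xs i ≡ nth z xs j → i ≡ j
  nth-injective (_ ∷ _) {zero} {zero} _ _ _ = refl
  nth-injective {x ∷ xs} (x∉xs ∷ _) {zero} {suc j} _ (s≤s j<) eq =
    contradiction eq (All.lookup x∉xs (nth-∈ xs j<))
  nth-injective {x ∷ xs} (x∉xs ∷ _) {suc i} {zero} (s≤s i<) _ eq =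
    contradiction (sym eq) (All.lookup x∉xs (nth-∈ xs i<))
  nth-injective (_ ∷ u) {suc i} {suc j} (s≤s i<) (s≤s j<) eq = cong suc (nth-injective u i< j< eq)

module _ {E : Fin n → Fin n → Bool} (z : Fin n) where

  consecAdj-step : ∀ {first} xs prev → consecAdj E first xs prev → ∀ {i} → i < length xs →
                   E (nth z (prev ∷ xs) i) (nth z (prev ∷ xs) (suc i)) ≡ true
  consecAdj-step (x ∷ xs) prev (e , _) {zero} _ = e
  consecAdj-step (x ∷ xs) prev (_ , adj) {suc i} (s≤s i<) = consecAdj-step xs x adj i<

  consecAdj-close : ∀ {first} xs prev → consecAdj E first xs prev →
                    E (nth z (prev ∷ xs) (length xs)) first ≡ true
  consecAdj-close [] prev e = e
  consecAdj-close (x ∷ xs) prev (_ , adj) = consecAdj-close xs x adj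

module CycleList {E : Fin n → Fin n → Bool} (v : Fin n) (vs : List (Fin n))
                 (cyc : IsCycle E (v ∷ vs)) where

  g : ℕ
  g = length (v ∷ vs)

  private
    at : ℕ → Fin n
    at = nth v (v ∷ vs)

    3≤g : 3 ≤ g
    3≤g = proj₁ cyc

    unique : Unique (v ∷ vs)
    unique = proj₁ (proj₂ cyc)

    adjacent : consecAdj E v vs v
    adjacent = proj₂ (proj₂ cyc)

    at-step : ∀ r → r < g → E (at r) (at (suc r % g)) ≡ true
    at-step r r<g with m≤n⇒m<n∨m≡n (≤-pred r<g)
    ... | inj₁ r<len = subst (λ i → E (at r) (at i) ≡ true) (sym (m<n⇒m%n≡m (s≤s r<len)))
                             (consecAdj-step v vs v adjacent r<len)
    ... | inj₂ refl = subst (λ i → E (at (length vs)) (at i) ≡ true) (sym (n%n≡0 g))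
                            (consecAdj-close v vs v adjacent)

  w : ℕ → Fin n
  w j = at (j % g)

  w-periodic : ∀ j → w (j + g) ≡ w j
  w-periodic j = cong at ([m+n]%n≡m%n j g)

  w-step : ∀ j → E (w j) (w (suc j)) ≡ true
  w-step j = subst (λ r → E (w j) (at r) ≡ true) (sym suc-%) (at-step (j % g) (m%n<n j g))
    where
    suc-% : suc j % g ≡ suc (j % g) % g
    suc-% = trans (%-distribˡ-+ 1 j g)
                  (cong (λ r → (r + j % g) % g) (m<n⇒m%n≡m (≤-trans (s≤s (s≤s z≤n)) 3≤g)))

  -- (c + g - 1) + 2 = (c + 1) + g, and 2 < g since a cycle has at least three vertices.
  w-neighbours-distinct : ∀ c → w (suc c) ≢ w (c + pred g)
  w-neighbours-distinct c eq = %-+-≢ (c + pred g) {2} 3≤g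
    (nth-injective v unique (m%n<n (c + pred g + 2) g) (m%n<n (c + pred g) g) (trans wrap eq))
    where
    shift : ∀ c h → c + h + 2 ≡ suc c + suc h
    shift = solve-∀

    wrap : w (c + pred g + 2) ≡ w (suc c)
    wrap = trans (cong w (shift c (pred g))) (w-periodic (suc c))

module CycleArgument
    {E : Fin n → Fin n → Bool} {d : Fin n → Fin n → ℕ} {ID : Fin n → ℕ} {p : Fin n → Fin n → Fin n}
    (E-sym : ∀ u v → E u v ≡ E v u) (hop : IsHopDistance E d) (bfs : IsBFSParent E d p)
    {v : Fin n} {vs : List (Fin n)} (cyc : IsCycle E (v ∷ vs)) where

  open HopDistance E-sym hop
  open CycleList v vs cyc
  open ClosedWalk E-sym hop g w w-step w-periodic
  open Closeness d ID
  open ≤-Reasoning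

  module _ (S : Fin n → Bool) (k : ℕ) (s : Fin n) (covered : ∀ c → inU d ID S k (w c) s ≡ true)
           (a : ℕ) where

    Est-≤ₘ-edge : ∀ e → parentNot p s (w e) (w (suc e)) ≡ true →
                  parentNot p s (w (suc e)) (w e) ≡ true →
                  Est E d ID p S k ≤ₘ d (w a) s + d (w a) s + g
    Est-≤ₘ-edge e ok ok′ =
      ≤ₘ-trans (Est-≤ₘ E d ID p S k (w-step e) (covered e) (covered (suc e)) ok ok′) (begin
      d s (w e) + d s (w (suc e)) + 1                   ≤⟨ +-monoˡ-≤ 1 (+-mono-≤ (via e) (via (suc e))) ⟩
      r + d (w a) (w e) + (r + d (w a) (w (suc e))) + 1 ≡⟨ regroup r (d (w a) (w e)) (d (w a) (w (suc e))) ⟩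
      r + r + (d (w a) (w e) + d (w a) (w (suc e)) + 1) ≤⟨ +-monoʳ-≤ (r + r) (d-cycle-edge a e) ⟩
      r + r + g                                         ∎)
      where
      r : ℕ
      r = d (w a) s

      via : ∀ c → d s (w c) ≤ r + d (w a) (w c)
      via c = subst (λ x → d s (w c) ≤ x + d (w a) (w c)) (d-sym s (w a))
                    (d-triangle s (w a) (w c))

      regroup : ∀ r x y → r + x + (r + y) + 1 ≡ r + r + (x + y + 1)
      regroup = solve-∀

    module _ (c : ℕ) (far : ∀ c′ → d s (w c′) ≤ d s (w c)) where

      no-child : ∀ c′ → parentNot p s (w c′) (w c) ≡ true
      no-child c′ with parentNot-or-parent p s (w c′) (w c)
      ... | inj₁ ok = ok
      ... | inj₂ (c′≢s , p≡c) = contradiction (≤-trans (≤-reflexive deeper) (far c′)) (<-irrefl refl)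
        where
        deeper : suc (d s (w c)) ≡ d s (w c′)
        deeper = subst (λ x → suc (d s x) ≡ d s (w c′)) p≡c (proj₂ (bfs s (w c′) c′≢s))

      Est-≤ₘ-farthest : Est E d ID p S k ≤ₘ d (w a) s + d (w a) s + g
      Est-≤ₘ-farthest with parentNot-or-parent p s (w c) (w (suc c))
                         | parentNot-or-parent p s (w c) (w (c + pred g))
      ... | inj₁ ok | _ = Est-≤ₘ-edge c ok (no-child (suc c))
      ... | inj₂ _ | inj₁ ok = Est-≤ₘ-edge (c + pred g)
        (subst (λ x → parentNot p s (w (c + pred g)) x ≡ true) (sym (w-pred c)) (no-child (c + pred g)))
        (subst (λ x → parentNot p s x (w (c + pred g)) ≡ true) (sym (w-pred c)) ok)
      ... | inj₂ (_ , p≡next) | inj₂ (_ , p≡prev) =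
        contradiction (trans (sym p≡next) p≡prev) (w-neighbours-distinct c)

    Est-≤ₘ-cycle : Est E d ID p S k ≤ₘ d (w a) s + d (w a) s + g
    Est-≤ₘ-cycle = let (c , far) = farthest (d s) in Est-≤ₘ-farthest c far

  module _ {f k : ℕ} {A : ℕ → Fin n → Bool} (1≤f : 1 ≤ f) (good : GoodSampling d ID f k A) where

    record Reached (i : ℕ) : Set where
      constructor reached
      field
        source   : Fin n
        anchor   : ℕ
        source∈A : A i source ≡ true
        near     : d (w anchor) source + d (w anchor) source ≤ g * i

    Success : Set
    Success = ∃ λ i → i < f × Est E d ID p (A i) k ≤ₘ g * suc i

    escape : ∀ {i} → i < f → (R : Reached i) →
             ∀ b → inU d ID (A i) k (w b) (Reached.source R) ≢ true →
             suc i < f × Reached (suc i)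
    escape {i} i<f (reached s a s∈A near) b s∉U =
      1+i<f , from-sample (proj₁ good (suc i) (s≤s z≤n) 1+i<f (w b))
      where
      s∉Q : inQ d ID f (suc i) (w b) s ≢ true
      s∉Q = ∉U⇒∉Q {f} {suc i} s∈A s∉U (proj₂ good i i<f (w b))

      1+i<f : suc i < f
      1+i<f with m≤n⇒m<n∨m≡n i<f
      ... | inj₁ 1+i<f = 1+i<f
      ... | inj₂ refl = contradiction (inQ-top 1≤f (w b) s) s∉Q

      regroup : ∀ x r → x + r + (x + r) ≡ x + x + (r + r)
      regroup = solve-∀

      from-sample : (∃ λ s′ → inQ d ID f (suc i) (w b) s′ ≡ true × A (suc i) s′ ≡ true) →
                    Reached (suc i)
      from-sample (s′ , s′∈Q , s′∈A) = reached s′ b s′∈A (begin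
        d (w b) s′ + d (w b) s′                                 ≤⟨ +-mono-≤ s′-near s′-near ⟩
        d (w b) (w a) + d (w a) s + (d (w b) (w a) + d (w a) s) ≡⟨ regroup (d (w b) (w a)) (d (w a) s) ⟩
        d (w b) (w a) + d (w b) (w a) + (d (w a) s + d (w a) s) ≤⟨ +-mono-≤ (d-cycle-double b a) near ⟩
        g + g * i                                               ≡⟨ *-suc g i ⟨
        g * suc i                                               ∎)
        where
        s′-near : d (w b) s′ ≤ d (w b) (w a) + d (w a) s
        s′-near = ≤-trans (inQ-nearer {f} {suc i} s∉Q s′∈Q) (d-triangle (w b) (w a) s)

    round : ∀ {i} → i < f → Reached i → Success ⊎ (suc i < f × Reached (suc i))
    round {i} i<f R@(reached s a s∈A near)
      with all-or-counterexample (λ x → inU d ID (A i) k x s Bool.≟ true)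
    ... | inj₁ covered = inj₁ (i , i<f , ≤ₘ-trans (Est-≤ₘ-cycle (A i) k s covered a) (begin
      d (w a) s + d (w a) s + g ≤⟨ +-monoˡ-≤ g near ⟩
      g * i + g                 ≡⟨ +-comm (g * i) g ⟩
      g + g * i                 ≡⟨ *-suc g i ⟨
      g * suc i                 ∎))
    ... | inj₂ (b , s∉U) = inj₂ (escape i<f R b s∉U)

    climb : ∀ fuel {i} → f ≤ i + fuel → i < f → Reached i → Success
    climb zero {i} f≤i i<f _ = contradiction (subst (f ≤_) (+-identityʳ i) f≤i) (<⇒≱ i<f)
    climb (suc fuel) {i} f≤ i<f R with round i<f R
    ... | inj₁ success = success
    ... | inj₂ (1+i<f , R′) = climb fuel (subst (f ≤_) (+-suc i fuel) f≤) 1+i<f R′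

    Est-≤ₘ-some-level : (∀ x → A 0 x ≡ true) → Success
    Est-≤ₘ-some-level A₀ = climb f ≤-refl 1≤f (reached v 0 (A₀ v) v-near-v)
      where
      v-near-v : d v v + d v v ≤ g * 0
      v-near-v rewrite d-refl v = z≤n

-- Unused: connectivity (IsHopDistance already provides walks), injectivity of ID (closer is a
-- strict order for any ID), and f < n and KLarge (they only make a good sampling likely).
claim6 : (n : ℕ) (E : Fin n → Fin n → Bool) (d : Fin n → Fin n → ℕ) (ID : Fin n → ℕ)
         (p : Fin n → Fin n → Fin n) (g f k : ℕ) (A : ℕ → Fin n → Bool) →
         IsSimpleGraph E → Connected E → IsHopDistance E d →
         Injective _≡_ _≡_ ID → IsBFSParent E d p → IsGirth E g →
         1 ≤ f → f < n → KLarge n f k →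
         (∀ (v : Fin n) → A 0 v ≡ true) → GoodSampling d ID f k A →
         ∃ λ (i : ℕ) → (i < f) × (∃ λ (m : ℕ) → (Est E d ID p (A i) k ≡ just m) × (m ≤ g * suc i))
claim6 n E d ID p g f k A simple _ hop _ bfs (([] , () , _) , _) 1≤f _ _ A₀ good
claim6 n E d ID p _ f k A simple _ hop _ bfs ((v ∷ vs , cyc , refl) , _) 1≤f _ _ A₀ good =
  CycleArgument.Est-≤ₘ-some-level {ID = ID} (proj₁ simple) hop bfs cyc 1≤f good A₀
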